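{- Let $m,k$ be positive integers, $\ell$ an even positive integer, $X=\{1,\dots,m\}$, and $\mathcal{Y}=(Y_1,\dots,Y_k)$ a $k$-cover of $X$. Then the code $C(\mathcal{Y})$ is a binary LCD $[\ell m+k,k]$ code with $d(C(\mathcal{Y})^\perp)=2$.
   Context: A $k$-cover of $X$ is a sequence $(Y_1,\dots,Y_k)$ of (not necessarily distinct) subsets of $X$ whose union is $X$. For a positive integer $a$ write $a+Y=\{a+y \mid y\in Y\}$. Define subsets of $\{1,\dots,k+\ell m\}$ by $Z_i=\{i\}\cup (k+Y_i)\cup(k+m+Y_i)\cup\cdots\cup(k+(\ell-1)m+Y_i)$ for $i=1,\dots,k$. Let $z_i\in\mathbb{F}_2^{k+\ell m}$ be the characteristic vector of $Z_i$ (the $j$-th coordinate is $1$ iff $j\in Z_i$). $G(\mathcal{Y})$ is the $k\times(k+\ell m)$ binary matrix with $i$-th row $z_i$, and $C(\mathcal{Y})$ is the binary linear code generated by its rows. A binary $[n,k]$ code is a $k$-dimensional subspace of $\mathbb{F}_2^n$; a code $C$ is LCD if $C\cap C^\perp=\{\mathbf{0}_n\}$ (dual with respect to the standard inner product); $d(D)$ denotes the minimum nonzero Hamming weight of a code $D$. -}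

module Defs where

open import Data.Bool using (Bool; true; false; _xor_; _∧_; if_then_else_)
open import Data.Nat using (ℕ; zero; suc; _+_; _*_; _≤_)
open import Data.Fin using (Fin; zero; suc; splitAt; remainder; _≟_)
open import Data.Sum using (inj₁; inj₂)
open import Data.Product using (Σ; ∃; _×_)
open import Relation.Nullary using (¬_; does)
open import Relation.Binary.PropositionalEquality using (_≡_)

-- F₂ is modelled by Bool (addition = xor, multiplication = ∧).
-- A word of length n is a function Fin n → Bool (coordinates 1..n ↦ Fin n).
Word : ℕ → Set
Word n = Fin n → Bool

Code : ℕ → Set₁
Code n = Word n → Set

⊕-sum : ∀ {k} → (Fin k → Bool) → Bool
⊕-sum {zero}  f = false
⊕-sum {suc k} f = f zero xor ⊕-sum (λ i → f (suc i))

lincomb : ∀ {k n} → (Fin k → Bool) → (Fin k → Word n) → Word n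
lincomb c g j = ⊕-sum (λ i → c i ∧ g i j)

_≈w_ : ∀ {n} → Word n → Word n → Set
v ≈w w = ∀ j → v j ≡ w j

IsZero : ∀ {n} → Word n → Set
IsZero v = ∀ j → v j ≡ false

Span : ∀ {k n} → (Fin k → Word n) → Code n
Span {k} g v = Σ (Fin k → Bool) λ c → v ≈w lincomb c g

dot : ∀ {n} → Word n → Word n → Bool
dot v w = ⊕-sum (λ j → v j ∧ w j)

Dual : ∀ {n} → Code n → Code n
Dual C v = ∀ w → C w → dot v w ≡ false

LinIndep : ∀ {k n} → (Fin k → Word n) → Set
LinIndep g = ∀ c → IsZero (lincomb c g) → ∀ i → c i ≡ false

HasDim : ∀ {n} → Code n → ℕ → Set
HasDim {n} C k = Σ (Fin k → Word n) λ b →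
  (∀ v → (C v → Span b v) × (Span b v → C v)) × LinIndep b

IsLinearCode : ∀ n → ℕ → Code n → Set
IsLinearCode n k C = HasDim C k

IsLCD : ∀ {n} → Code n → Set
IsLCD C = ∀ v → C v → Dual C v → IsZero v

weight : ∀ {n} → Word n → ℕ
weight {zero}  v = 0
weight {suc n} v = (if v zero then 1 else 0) + weight (λ j → v (suc j))

MinDist : ∀ {n} → Code n → ℕ → Set
MinDist D d =
  (∃ λ v → D v × ¬ IsZero v × weight v ≡ d) ×
  (∀ v → D v → ¬ IsZero v → d ≤ weight v)

IsCover : ∀ {k m} → (Fin k → Fin m → Bool) → Set
IsCover {k} Y = ∀ x → ∃ λ (i : Fin k) → Y i x ≡ true

-- The row z_i of G(𝒴): characteristic vector of
-- Z_i = {i} ∪ (k+Y_i) ∪ (k+m+Y_i) ∪ ... ∪ (k+(ℓ-1)m+Y_i) ⊆ {1..k+ℓm}.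
-- Coordinate j ∈ Fin (k + ℓ*m): either j < k (position i iff j = i),
-- or j = k + t*m + y with t < ℓ, y < m (in Z_i iff y ∈ Y_i).
genRow : ∀ {k m} (ℓ : ℕ) → (Fin k → Fin m → Bool) → Fin k → Word (k + ℓ * m)
genRow {k} {m} ℓ Y i j with splitAt k j
... | inj₁ j′ = does (i ≟ j′)
... | inj₂ r  = Y i (remainder {ℓ} m r)

C𝒴 : ∀ {k m} (ℓ : ℕ) → (Fin k → Fin m → Bool) → Code (k + ℓ * m)
C𝒴 ℓ Y = Span (genRow ℓ Y)

-- Over F₂ the rows of G(𝒴) satisfy G Gᵀ = I: the identity block contributes δᵢⱼ to
-- zᵢ·zⱼ, and the Y-part contributes |Yᵢ ∩ Yⱼ| once per block, i.e. an even number
-- ℓ of times. Hence a codeword c G orthogonal to every row has c = c G Gᵀ = 0, so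
-- C(𝒴) is LCD; the identity block also makes the rows independent. A weight-one
-- word eⱼ is dual only if column j of G vanishes, which the cover condition
-- forbids, while the coordinates k + y and k + m + y carry equal columns, so
-- their sum is a dual word of weight two.
module Submission where

open import Defs
open import Data.Bool using (Bool; true; false; _xor_; _∧_; _∨_; if_then_else_)
open import Data.Bool.Properties
  using ( xor-assoc; xor-comm; xor-identityʳ; xor-same
        ; ∧-comm; ∧-zeroʳ; ∧-identityʳ; ∨-zeroʳ; ∨-identityʳ; ¬-not )
  renaming (_≟_ to _≟ᵇ_)
open import Data.Nat using (ℕ; zero; suc; _+_; _*_; _≤_; z≤n)
open import Data.Nat.Properties using (≤-refl; ≤-trans; ≤-reflexive; +-mono-≤)
open import Data.Nat.Divisibility using (_∣_; divides)
open import Data.Fin using (Fin; zero; suc; _≟_; _↑ˡ_; _↑ʳ_; splitAt; remainder; combine)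
open import Data.Fin.Properties
  using ( suc-injective; ↑ʳ-injective; splitAt-↑ˡ; splitAt-↑ʳ
        ; remQuot-combine; combine-injectiveˡ; any?; ¬∀⟶∃¬ )
open import Data.Sum using (inj₁; inj₂)
open import Data.Product using (_×_; _,_; ∃; proj₂)
open import Function using (_∘_; id)
open import Relation.Nullary using (¬_; does; yes; no; contradiction)
open import Relation.Nullary.Decidable using (¬?; _×-dec_; dec-true; dec-false)
open import Relation.Binary.PropositionalEquality

⊕-sum-cong : ∀ {k} {f g : Fin k → Bool} → (∀ i → f i ≡ g i) → ⊕-sum f ≡ ⊕-sum g
⊕-sum-cong {zero}  f≗g = refl
⊕-sum-cong {suc k} f≗g = cong₂ _xor_ (f≗g zero) (⊕-sum-cong (f≗g ∘ suc))

⊕-sum-false : ∀ {k} {f : Fin k → Bool} → (∀ i → f i ≡ false) → ⊕-sum f ≡ false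
⊕-sum-false {zero}  f≡false = refl
⊕-sum-false {suc k} f≡false rewrite f≡false zero = ⊕-sum-false (f≡false ∘ suc)

⊕-sum-single : ∀ {k} {f : Fin k → Bool} a → (∀ j → j ≢ a → f j ≡ false) → ⊕-sum f ≡ f a
⊕-sum-single {suc k} {f} zero    off =
  trans (cong (f zero xor_) (⊕-sum-false (λ j → off (suc j) λ ()))) (xor-identityʳ (f zero))
⊕-sum-single {suc k}     (suc a) off rewrite off zero (λ ()) =
  ⊕-sum-single a (λ j j≢a → off (suc j) (j≢a ∘ suc-injective))

⊕-sum-pair : ∀ {k} {f : Fin k → Bool} {a b} → a ≢ b →
  (∀ j → j ≢ a → j ≢ b → f j ≡ false) → ⊕-sum f ≡ f a xor f b
⊕-sum-pair {a = zero}  {zero}  a≢b off = contradiction refl a≢b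
⊕-sum-pair {f = f} {zero}  {suc b} a≢b off =
  cong (f zero xor_) (⊕-sum-single b (λ j j≢b → off (suc j) (λ ()) (j≢b ∘ suc-injective)))
⊕-sum-pair {f = f} {suc a} {zero}  a≢b off =
  trans (cong (f zero xor_) (⊕-sum-single a (λ j j≢a → off (suc j) (j≢a ∘ suc-injective) (λ ()))))
        (xor-comm (f zero) _)
⊕-sum-pair {a = suc a} {suc b} a≢b off rewrite off zero (λ ()) (λ ()) =
  ⊕-sum-pair (a≢b ∘ cong suc)
    (λ j j≢a j≢b → off (suc j) (j≢a ∘ suc-injective) (j≢b ∘ suc-injective))

⊕-sum-select : ∀ {k} (f : Fin k → Bool) i → ⊕-sum (λ j → f j ∧ does (j ≟ i)) ≡ f i
⊕-sum-select f i = trans (⊕-sum-single i off) on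
  where
  off : ∀ j → j ≢ i → f j ∧ does (j ≟ i) ≡ false
  off j j≢i = trans (cong (f j ∧_) (dec-false (j ≟ i) j≢i)) (∧-zeroʳ (f j))
  on : f i ∧ does (i ≟ i) ≡ f i
  on = trans (cong (f i ∧_) (dec-true (i ≟ i) refl)) (∧-identityʳ (f i))

does-≟-comm : ∀ {n} (i j : Fin n) → does (i ≟ j) ≡ does (j ≟ i)
does-≟-comm i j with i ≟ j
... | yes i≡j = sym (dec-true (j ≟ i) (sym i≡j))
... | no  i≢j = sym (dec-false (j ≟ i) (i≢j ∘ sym))

⊕-sum-++ : ∀ k {n} (f : Fin (k + n) → Bool) →
  ⊕-sum f ≡ ⊕-sum (λ i → f (i ↑ˡ n)) xor ⊕-sum (λ r → f (k ↑ʳ r))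
⊕-sum-++ zero    f = refl
⊕-sum-++ (suc k) f =
  trans (cong (f zero xor_) (⊕-sum-++ k (f ∘ suc))) (sym (xor-assoc (f zero) _ _))

⊕-sum-periodic : ∀ q m (h : Fin m → Bool) →
  ⊕-sum (h ∘ remainder {suc q} m) ≡ ⊕-sum h xor ⊕-sum (h ∘ remainder {q} m)
⊕-sum-periodic q m h = trans (⊕-sum-++ m (h ∘ remainder {suc q} m))
  (cong₂ _xor_ (⊕-sum-cong (λ y → cong h (remainder-↑ˡ y)))
               (⊕-sum-cong (λ r → cong h (remainder-↑ʳ r))))
  where
  remainder-↑ˡ : ∀ y → remainder {suc q} m (y ↑ˡ q * m) ≡ y
  remainder-↑ˡ y rewrite splitAt-↑ˡ m y (q * m) = refl
  remainder-↑ʳ : ∀ r → remainder {suc q} m (m ↑ʳ r) ≡ remainder {q} m r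
  remainder-↑ʳ r rewrite splitAt-↑ʳ m (q * m) r = refl

⊕-sum-periodic-even : ∀ {ℓ} m (h : Fin m → Bool) → 2 ∣ ℓ → ⊕-sum (h ∘ remainder {ℓ} m) ≡ false
⊕-sum-periodic-even m h (divides zero    refl) = refl
⊕-sum-periodic-even m h (divides (suc q) refl) = begin
  periods (2 + q * 2)            ≡⟨ ⊕-sum-periodic (suc (q * 2)) m h ⟩
  H xor periods (1 + q * 2)      ≡⟨ cong (H xor_) (⊕-sum-periodic (q * 2) m h) ⟩
  H xor (H xor periods (q * 2))  ≡⟨ cong (λ s → H xor (H xor s)) (⊕-sum-periodic-even m h (divides q refl)) ⟩
  H xor (H xor false)            ≡⟨ cong (H xor_) (xor-identityʳ H) ⟩
  H xor H                        ≡⟨ xor-same H ⟩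
  false                          ∎
  where
  open ≡-Reasoning
  H : Bool
  H = ⊕-sum h
  periods : ∀ ℓ → Bool
  periods ℓ = ⊕-sum (h ∘ remainder {ℓ} m)

weight-false : ∀ {n} → weight {n} (λ _ → false) ≡ 0
weight-false {zero}  = refl
weight-false {suc n} = weight-false {n}

weight-cong : ∀ {n} {v w : Word n} → v ≈w w → weight v ≡ weight w
weight-cong {zero}  v≈w = refl
weight-cong {suc n} v≈w =
  cong₂ _+_ (cong (λ b → if b then 1 else 0) (v≈w zero)) (weight-cong (v≈w ∘ suc))

weight-mono : ∀ {n} {v w : Word n} → (∀ j → v j ≡ true → w j ≡ true) → weight v ≤ weight w
weight-mono {zero}  v⊆w = z≤n
weight-mono {suc n} v⊆w = +-mono-≤ (indicator-mono (v⊆w zero)) (weight-mono (v⊆w ∘ suc))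
  where
  indicator-mono : ∀ {a b} → (a ≡ true → b ≡ true) → (if a then 1 else 0) ≤ (if b then 1 else 0)
  indicator-mono {false} a⇒b = z≤n
  indicator-mono {true}  a⇒b rewrite a⇒b refl = ≤-refl

pairWord : ∀ {n} → Fin n → Fin n → Word n
pairWord a b j = does (j ≟ a) ∨ does (j ≟ b)

pairWord-atˡ : ∀ {n} (a b : Fin n) → pairWord a b a ≡ true
pairWord-atˡ a b = cong (_∨ does (a ≟ b)) (dec-true (a ≟ a) refl)

pairWord-atʳ : ∀ {n} (a b : Fin n) → pairWord a b b ≡ true
pairWord-atʳ a b = trans (cong (does (b ≟ a) ∨_) (dec-true (b ≟ b) refl)) (∨-zeroʳ _)

pairWord-off : ∀ {n} {a b j : Fin n} → j ≢ a → j ≢ b → pairWord a b j ≡ false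
pairWord-off {a = a} {b} {j} j≢a j≢b = cong₂ _∨_ (dec-false (j ≟ a) j≢a) (dec-false (j ≟ b) j≢b)

weight-unit : ∀ {n} (a : Fin n) → weight (λ j → does (j ≟ a)) ≡ 1
weight-unit {suc n} zero = cong suc (weight-false {n})
weight-unit (suc a)      = weight-unit a

weight-pairWord : ∀ {n} {a b : Fin n} → a ≢ b → weight (pairWord a b) ≡ 2
weight-pairWord {a = zero}  {zero}  a≢b = contradiction refl a≢b
weight-pairWord {a = zero}  {suc b} a≢b = cong suc (weight-unit b)
weight-pairWord {a = suc a} {zero}  a≢b =
  cong suc (trans (weight-cong (λ j → ∨-identityʳ (does (j ≟ a)))) (weight-unit a))
weight-pairWord {a = suc a} {suc b} a≢b = weight-pairWord (a≢b ∘ cong suc)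

pairWord-⊆ : ∀ {n} {v : Word n} {a b} → v a ≡ true → v b ≡ true →
  ∀ j → pairWord a b j ≡ true → v j ≡ true
pairWord-⊆ {a = a} {b} va vb j p with j ≟ a | j ≟ b
... | yes refl | _        = va
... | no _     | yes refl = vb
... | no _     | no _     = contradiction p λ ()

weight≥2 : ∀ {n} {v : Word n} {a b} → a ≢ b → v a ≡ true → v b ≡ true → 2 ≤ weight v
weight≥2 {a = a} {b} a≢b va vb =
  ≤-trans (≤-reflexive (sym (weight-pairWord a≢b)))
          (weight-mono {v = pairWord a b} (pairWord-⊆ va vb))

module _ {k n} (g : Fin k → Word n) where

  generator-∈-Span : ∀ i → Span g (g i)
  generator-∈-Span i = (λ i′ → does (i′ ≟ i)) , λ j →
    sym (trans (⊕-sum-cong (λ i′ → ∧-comm (does (i′ ≟ i)) (g i′ j))) (⊕-sum-select (λ i′ → g i′ j) i))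

  Span-HasDim : LinIndep g → HasDim (Span g) k
  Span-HasDim indep = g , (λ _ → id , id) , indep

  equalColumns⇒pairWord-∈-Dual : ∀ {a b} → a ≢ b → (∀ i → g i a ≡ g i b) →
    Dual (Span g) (pairWord a b)
  equalColumns⇒pairWord-∈-Dual {a} {b} a≢b ga≡gb w (c , w≈) = begin
    dot (pairWord a b) w
      ≡⟨ ⊕-sum-pair a≢b (λ j j≢a j≢b → cong (_∧ w j) (pairWord-off j≢a j≢b)) ⟩
    pairWord a b a ∧ w a xor pairWord a b b ∧ w b
      ≡⟨ cong₂ (λ x y → x ∧ w a xor y ∧ w b) (pairWord-atˡ a b) (pairWord-atʳ a b) ⟩
    w a xor w b
      ≡⟨ cong (_xor w b) wa≡wb ⟩
    w b xor w b
      ≡⟨ xor-same (w b) ⟩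
    false ∎
    where
    open ≡-Reasoning
    wa≡wb : w a ≡ w b
    wa≡wb = trans (w≈ a) (trans (⊕-sum-cong (λ i → cong (c i ∧_) (ga≡gb i))) (sym (w≈ b)))

  noZeroColumn⇒Dual-weight≥2 : (∀ j → ∃ λ i → g i j ≡ true) →
    ∀ {v} → Dual (Span g) v → ¬ IsZero v → 2 ≤ weight v
  noZeroColumn⇒Dual-weight≥2 covered {v} v⊥ v≢0
    with a , va≢false ← ¬∀⟶∃¬ n (λ j → v j ≡ false) (λ j → v j ≟ᵇ false) v≢0
    with any? (λ b → ¬? (b ≟ a) ×-dec (v b ≟ᵇ true))
  ... | yes (b , b≢a , vb) = weight≥2 (b≢a ∘ sym) (¬-not va≢false) vb
  ... | no ∄b with i , gia ← covered a =
    contradiction (v⊥ (g i) (generator-∈-Span i)) v·gi≢false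
    where
    vj≡false : ∀ j → j ≢ a → v j ≡ false
    vj≡false j j≢a = ¬-not (λ vj → ∄b (j , j≢a , vj))
    v·gi≢false : dot v (g i) ≢ false
    v·gi≢false v·gi≡false = contradiction (begin
      true          ≡⟨ cong₂ _∧_ (¬-not va≢false) gia ⟨
      v a ∧ g i a   ≡⟨ ⊕-sum-single a (λ j j≢a → cong (_∧ g i j) (vj≡false j j≢a)) ⟨
      dot v (g i)   ≡⟨ v·gi≡false ⟩
      false         ∎) λ ()
      where open ≡-Reasoning

  MinDist-Dual-Span : (∀ j → ∃ λ i → g i j ≡ true) →
    ∀ {a b} → a ≢ b → (∀ i → g i a ≡ g i b) → MinDist (Dual (Span g)) 2
  MinDist-Dual-Span covered {a} {b} a≢b ga≡gb =
    (pairWord a b , equalColumns⇒pairWord-∈-Dual a≢b ga≡gb , pairWord≢0 , weight-pairWord a≢b) ,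
    λ _ → noZeroColumn⇒Dual-weight≥2 covered
    where
    pairWord≢0 : ¬ IsZero (pairWord a b)
    pairWord≢0 z = contradiction (trans (sym (pairWord-atˡ a b)) (z a)) λ ()

module GeneratorMatrix {k m} (ℓ : ℕ) (Y : Fin k → Fin m → Bool) where

  G : Fin k → Word (k + ℓ * m)
  G = genRow ℓ Y

  genRow-↑ˡ : ∀ i j → G i (j ↑ˡ ℓ * m) ≡ does (i ≟ j)
  genRow-↑ˡ i j rewrite splitAt-↑ˡ k j (ℓ * m) = refl

  genRow-↑ʳ : ∀ i r → G i (k ↑ʳ r) ≡ Y i (remainder {ℓ} m r)
  genRow-↑ʳ i r rewrite splitAt-↑ʳ k (ℓ * m) r = refl

  genRow-combine : ∀ i (t : Fin ℓ) y → G i (k ↑ʳ combine t y) ≡ Y i y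
  genRow-combine i t y = trans (genRow-↑ʳ i _) (cong (Y i ∘ proj₂) (remQuot-combine {ℓ} t y))

  lincomb-genRow-↑ˡ : ∀ c i → lincomb c G (i ↑ˡ ℓ * m) ≡ c i
  lincomb-genRow-↑ˡ c i = trans (⊕-sum-cong (λ i′ → cong (c i′ ∧_) (genRow-↑ˡ i′ i))) (⊕-sum-select c i)

  lincomb-genRow-↑ʳ : ∀ c r → lincomb c G (k ↑ʳ r) ≡ lincomb c Y (remainder {ℓ} m r)
  lincomb-genRow-↑ʳ c r = ⊕-sum-cong (λ i → cong (c i ∧_) (genRow-↑ʳ i r))

  genRow-linIndep : LinIndep G
  genRow-linIndep c c·G≡0 i = trans (sym (lincomb-genRow-↑ˡ c i)) (c·G≡0 (i ↑ˡ ℓ * m))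

  genRow-noZeroColumn : IsCover Y → ∀ j → ∃ λ i → G i j ≡ true
  genRow-noZeroColumn cover j with splitAt k j
  ... | inj₁ j′ = j′ , dec-true (j′ ≟ j′) refl
  ... | inj₂ r  = cover (remainder {ℓ} m r)

  dot-lincomb-genRow : 2 ∣ ℓ → ∀ c i → dot (lincomb c G) (G i) ≡ c i
  dot-lincomb-genRow ℓ-even c i = begin
    dot (lincomb c G) (G i)
      ≡⟨ ⊕-sum-++ k (λ j → lincomb c G j ∧ G i j) ⟩
    ⊕-sum (λ j → lincomb c G (j ↑ˡ ℓ * m) ∧ G i (j ↑ˡ ℓ * m))
      xor ⊕-sum (λ r → lincomb c G (k ↑ʳ r) ∧ G i (k ↑ʳ r))
      ≡⟨ cong₂ _xor_ (⊕-sum-cong identityBlock) (⊕-sum-cong coverBlocks) ⟩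
    ⊕-sum (λ j → c j ∧ does (j ≟ i)) xor ⊕-sum (h ∘ remainder {ℓ} m)
      ≡⟨ cong₂ _xor_ (⊕-sum-select c i) (⊕-sum-periodic-even m h ℓ-even) ⟩
    c i xor false
      ≡⟨ xor-identityʳ (c i) ⟩
    c i ∎
    where
    open ≡-Reasoning
    h : Fin m → Bool
    h y = lincomb c Y y ∧ Y i y
    identityBlock : ∀ j → lincomb c G (j ↑ˡ ℓ * m) ∧ G i (j ↑ˡ ℓ * m) ≡ c j ∧ does (j ≟ i)
    identityBlock j = cong₂ _∧_ (lincomb-genRow-↑ˡ c j) (trans (genRow-↑ˡ i j) (does-≟-comm i j))
    coverBlocks : ∀ r → lincomb c G (k ↑ʳ r) ∧ G i (k ↑ʳ r) ≡ h (remainder {ℓ} m r)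
    coverBlocks r = cong₂ _∧_ (lincomb-genRow-↑ʳ c r) (genRow-↑ʳ i r)

  genRow-LCD : 2 ∣ ℓ → IsLCD (C𝒴 ℓ Y)
  genRow-LCD ℓ-even v (c , v≈) v⊥ j =
    trans (v≈ j) (⊕-sum-false (λ i → cong (_∧ G i j) (c≡false i)))
    where
    c≡false : ∀ i → c i ≡ false
    c≡false i = begin
      c i                       ≡⟨ dot-lincomb-genRow ℓ-even c i ⟨
      dot (lincomb c G) (G i)   ≡⟨ ⊕-sum-cong (λ j → cong (_∧ G i j) (v≈ j)) ⟨
      dot v (G i)               ≡⟨ v⊥ (G i) (generator-∈-Span G i) ⟩
      false                     ∎
      where open ≡-Reasoning

proposition3p1 : (m k ℓ : ℕ) → 1 ≤ m → 1 ≤ k → 1 ≤ ℓ → 2 ∣ ℓ →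
    (Y : Fin k → Fin m → Bool) → IsCover Y →
    IsLinearCode (k + ℓ * m) k (C𝒴 ℓ Y) × IsLCD (C𝒴 ℓ Y) × MinDist (Dual (C𝒴 ℓ Y)) 2
proposition3p1 m k .(zero * 2) _ _ () (divides zero refl) Y cover
proposition3p1 (suc m) k ℓ@.(suc q * 2) _ _ _ ℓ-even@(divides (suc q) refl) Y cover =
  Span-HasDim G genRow-linIndep ,
  genRow-LCD ℓ-even ,
  MinDist-Dual-Span G (genRow-noZeroColumn cover) column₀≢column₁
    (λ i → trans (genRow-combine i zero zero) (sym (genRow-combine i (suc zero) zero)))
  where
  open GeneratorMatrix ℓ Y
  column : Fin ℓ → Fin (k + ℓ * suc m)
  column t = k ↑ʳ combine t zero
  column₀≢column₁ : column zero ≢ column (suc zero)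
  column₀≢column₁ eq
    with () ← combine-injectiveˡ {ℓ} zero zero (suc zero) zero (↑ʳ-injective k _ _ eq)
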